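{- For all $n\ge0$ and all pure $\lambda$-terms $t,u,v_1,\dots,v_n$ and variable $x$: if $u$ is $\lambda j$-strongly normalising and $t\{x/u\}\,v_1\dots v_n$ is $\lambda j$-strongly normalising, then $t[x/u]\,v_1\dots v_n$ is $\lambda j$-strongly normalising.
   Context: Terms of $\lambda j$: $t,u ::= x \mid \lambda x.t \mid t\,u \mid t[x/u]$; $[x/u]$ is a jump, $\lambda x.t$ and $t[x/u]$ bind $x$ in $t$ (not in $u$), terms modulo $\alpha$-conversion; pure $\lambda$-terms are terms without jumps. Application associates to the left. $|t|_x$ is the number of free occurrences of $x$ in $t$, $t\{x/u\}$ capture-avoiding meta-level substitution. When $|t|_x\ge2$, $t_{[y]_x}$ is any term obtained by renaming $i$ free occurrences of $x$ into a fresh $y$, $1\le i\le|t|_x-1$. Rules: (dB) $(\lambda x.t)L\,u\mapsto t[x/u]L$, $L=[y_1/w_1]\dots[y_k/w_k]$ a possibly empty list of jumps with $\{y_1,\dots,y_k\}\cap\mathrm{fv}(u)=\emptyset$; (w) $t[x/u]\mapsto t$ if $|t|_x=0$; (d) $t[x/u]\mapsto t\{x/u\}$ if $|t|_x=1$; (c) $t[x/u]\mapsto t_{[y]_x}[x/u][y/u]$ if $|t|_x>1$, $y$ fresh. $\to_{\lambda j}$ is the contextual closure; strongly normalising means no infinite $\to_{\lambda j}$-sequence. -}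

module Defs where

open import Data.Nat using (ℕ; zero; suc; _+_; _<_)
open import Data.Fin using (Fin; zero; suc)
open import Data.List using (List; []; _∷_; foldl)
open import Relation.Binary.PropositionalEquality using (_≡_; _≢_)
open import Induction.WellFounded using (Acc)
open import Relation.Nullary using (yes; no)
open import Data.Fin using (_≟_)

-- Tm n : terms with at most n free variables (indices Fin n).
-- lam t  : λx.t,     x is index 0 in t
-- jmp t u: t[x/u],   x is index 0 in t (bound in t, not in u)

data Tm (n : ℕ) : Set where
  var : Fin n → Tm n
  lam : Tm (suc n) → Tm n
  app : Tm n → Tm n → Tm n
  jmp : Tm (suc n) → Tm n → Tm n

data Pure {n : ℕ} : Tm n → Set where
  var : ∀ i → Pure (var i)
  lam : ∀ {t} → Pure t → Pure (lam t)
  app : ∀ {t u} → Pure t → Pure u → Pure (app t u)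

apps : ∀ {n} → Tm n → List (Tm n) → Tm n
apps = foldl app

Ren : ℕ → ℕ → Set
Ren m n = Fin m → Fin n

liftR : ∀ {m n} → Ren m n → Ren (suc m) (suc n)
liftR ρ zero    = zero
liftR ρ (suc i) = suc (ρ i)

ren : ∀ {m n} → Ren m n → Tm m → Tm n
ren ρ (var i)   = var (ρ i)
ren ρ (lam t)   = lam (ren (liftR ρ) t)
ren ρ (app t u) = app (ren ρ t) (ren ρ u)
ren ρ (jmp t u) = jmp (ren (liftR ρ) t) (ren ρ u)

weaken : ∀ {n} → Tm n → Tm (suc n)
weaken = ren suc

Sub : ℕ → ℕ → Set
Sub m n = Fin m → Tm n

liftS : ∀ {m n} → Sub m n → Sub (suc m) (suc n)
liftS σ zero    = var zero
liftS σ (suc i) = weaken (σ i)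

sub : ∀ {m n} → Sub m n → Tm m → Tm n
sub σ (var i)   = σ i
sub σ (lam t)   = lam (sub (liftS σ) t)
sub σ (app t u) = app (sub σ t) (sub σ u)
sub σ (jmp t u) = jmp (sub (liftS σ) t) (sub σ u)

sub0 : ∀ {n} → Tm n → Sub (suc n) n
sub0 u zero    = u
sub0 u (suc i) = var i

_[_]₀ : ∀ {n} → Tm (suc n) → Tm n → Tm n
t [ u ]₀ = sub (sub0 u) t

occ : ∀ {n} → Fin n → Tm n → ℕ
occ i (var j) with i ≟ j
... | yes _ = 1
... | no _ = 0
occ i (lam t)   = occ (suc i) t
occ i (app t u) = occ i t + occ i u
occ i (jmp t u) = occ (suc i) t + occ i u

-- Lists of jumps L = [y₁/w₁]…[yₖ/wₖ].
-- JL n m : a list of jumps whose body lives in scope m and whose result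
-- lives in scope n (m = n + k).  The outermost jump is first.

data JL (n : ℕ) : ℕ → Set where
  []  : JL n n
  _∷_ : ∀ {m} → Tm n → JL (suc n) m → JL n m

plug : ∀ {n m} → JL n m → Tm m → Tm n
plug []      t = t
plug (w ∷ L) t = jmp (plug L t) w

-- a term of the outer scope seen under the binders y₁…yₖ of L
-- (so that {y₁,…,yₖ} ∩ fv(u) = ∅ holds by construction)
wkL : ∀ {n m} → JL n m → Tm n → Tm m
wkL []      u = u
wkL (w ∷ L) u = wkL L (weaken u)

-- t_{[y]_x}: renaming some occurrences of x into a fresh y.
-- In a term s : Tm (suc (suc n)), index 0 plays x and index 1 plays y;
-- merge identifies y with x.

merge : ∀ {n} → Ren (suc (suc n)) (suc n)
merge zero          = zero
merge (suc zero)    = zero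
merge (suc (suc i)) = suc i

-- s is t_{[y]_x} where i = |s|_y occurrences were renamed,
-- with 1 ≤ i ≤ |t|_x - 1 (equivalently |s|_y ≥ 1 and |s|_x ≥ 1).
record Renamed {n : ℕ} (t : Tm (suc n)) (s : Tm (suc (suc n))) : Set where
  field
    collapse : ren merge s ≡ t
    someY    : 1 Data.Nat.≤ occ (suc zero) s
    someX    : 1 Data.Nat.≤ occ zero s

infix 4 _↦_ _⟶_

data _↦_ {n : ℕ} : Tm n → Tm n → Set where
  dB : ∀ {m} (t : Tm (suc m)) (L : JL n m) (u : Tm n) →
       app (plug L (lam t)) u ↦ plug L (jmp t (wkL L u))
  w  : ∀ (t : Tm (suc n)) (u : Tm n) → occ zero t ≡ 0 →
       jmp t u ↦ t [ u ]₀
  d  : ∀ (t : Tm (suc n)) (u : Tm n) → occ zero t ≡ 1 →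
       jmp t u ↦ t [ u ]₀
  c  : ∀ (t : Tm (suc n)) (u : Tm n) → 1 < occ zero t →
       (s : Tm (suc (suc n))) → Renamed t s →
       -- t_{[y]_x}[x/u][y/u]  (y outer binder = index 1, x inner = index 0)
       jmp t u ↦ jmp (jmp s (weaken u)) u

data _⟶_ {n : ℕ} : Tm n → Tm n → Set where
  root : ∀ {t t'} → t ↦ t' → t ⟶ t'
  lamC : ∀ {t t'} → t ⟶ t' → lam t ⟶ lam t'
  appL : ∀ {t t' u} → t ⟶ t' → app t u ⟶ app t' u
  appR : ∀ {t u u'} → u ⟶ u' → app t u ⟶ app t u'
  jmpL : ∀ {t t' u} → t ⟶ t' → jmp t u ⟶ jmp t' u
  jmpR : ∀ {t u u'} → u ⟶ u' → jmp t u ⟶ jmp t u'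

_⟵_ : ∀ {n} → Tm n → Tm n → Set
t ⟵ t' = t' ⟶ t

SN : ∀ {n} → Tm n → Set
SN t = Acc _⟵_ t

-- View t[x/u] v₁…vₙ as a stack of jumps t[x₁/u₁]…[xₖ/uₖ] v₁…vₙ in which no xᵢ is free in
-- any uⱼ, and whose unfolding is t{x₁/u₁,…,xₖ/uₖ} v₁…vₙ.  A step of the stack either reduces
-- the unfolding (a step in t or in some vⱼ, a dB step at the head, or a step in a uᵢ that is
-- used), or leaves it unchanged: a w or d step erases a jump, a c step splits one jump into
-- two with the same argument, and the remaining steps happen in unused uᵢ.  Erasing and
-- splitting strictly lower a weight Σᵢ w(|t|_{xᵢ}), and the steps in the uᵢ are bounded by
-- their strong normalisation.  Hence every stack with
-- strongly normalising arguments and a strongly normalising unfolding is strongly normalising,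
-- by lexicographic induction on (unfolding, weight, arguments).

module Submission where

open import Defs
open import Data.Nat using (ℕ; zero; suc; _+_; _<_; _≤_; s≤s)
open import Data.Nat.Properties using (+-identityʳ; ≤-reflexive; m≤n+m; +-monoʳ-<; +-commutativeSemigroup)
open import Data.Nat.Tactic.RingSolver using (solve-∀)
open import Algebra.Properties.CommutativeSemigroup +-commutativeSemigroup
  using () renaming (interchange to +-interchange)
open import Data.Fin using (Fin; zero; suc; _≟_)
open import Data.Fin.Properties using (suc-injective)
open import Data.List using (List; []; _∷_; length)
open import Data.List.Relation.Unary.All using (All; []; _∷_)
open import Data.Nat.Induction using (<-wellFounded)
open import Induction.WellFounded using (Acc; acc; WfRec; module Subrelation)
open import Data.Sum using (_⊎_; inj₁; inj₂)
open import Data.Product using (Σ; ∃; _×_; _,_)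
open import Data.Empty using (⊥-elim)
open import Function using (_∘_; id; flip)
open import Function.Definitions using (Injective)
open import Relation.Nullary using (Dec; yes; no)
open import Relation.Binary.PropositionalEquality
open import Relation.Binary.Construct.Closure.ReflexiveTransitive using (Star; ε; _◅_; _◅◅_; gmap)
open import Relation.Binary.Construct.Closure.Transitive using (TransClosure; [_]; _∷_; _∷ʳ_; accessible)

var-injective : ∀ {n} {i j : Fin n} → Tm.var i ≡ var j → i ≡ j
var-injective refl = refl

lam-injective : ∀ {n} {t t' : Tm (suc n)} → lam t ≡ lam t' → t ≡ t'
lam-injective refl = refl

app-injectiveˡ : ∀ {n} {t t' u u' : Tm n} → app t u ≡ app t' u' → t ≡ t'
app-injectiveˡ refl = refl

app-injectiveʳ : ∀ {n} {t t' u u' : Tm n} → app t u ≡ app t' u' → u ≡ u'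
app-injectiveʳ refl = refl

jmp-injectiveˡ : ∀ {n} {t t' : Tm (suc n)} {u u' : Tm n} → jmp t u ≡ jmp t' u' → t ≡ t'
jmp-injectiveˡ refl = refl

jmp-injectiveʳ : ∀ {n} {t t' : Tm (suc n)} {u u' : Tm n} → jmp t u ≡ jmp t' u' → u ≡ u'
jmp-injectiveʳ refl = refl

liftR-cong : ∀ {m n} {ρ ρ' : Ren m n} → ρ ≗ ρ' → liftR ρ ≗ liftR ρ'
liftR-cong e zero    = refl
liftR-cong e (suc i) = cong suc (e i)

ren-cong : ∀ {m n} {ρ ρ' : Ren m n} → ρ ≗ ρ' → ren ρ ≗ ren ρ'
ren-cong e (var i)   = cong var (e i)
ren-cong e (lam t)   = cong lam (ren-cong (liftR-cong e) t)
ren-cong e (app t u) = cong₂ app (ren-cong e t) (ren-cong e u)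
ren-cong e (jmp t u) = cong₂ jmp (ren-cong (liftR-cong e) t) (ren-cong e u)

liftS-cong : ∀ {m n} {σ σ' : Sub m n} → σ ≗ σ' → liftS σ ≗ liftS σ'
liftS-cong e zero    = refl
liftS-cong e (suc i) = cong weaken (e i)

sub-cong : ∀ {m n} {σ σ' : Sub m n} → σ ≗ σ' → sub σ ≗ sub σ'
sub-cong e (var i)   = e i
sub-cong e (lam t)   = cong lam (sub-cong (liftS-cong e) t)
sub-cong e (app t u) = cong₂ app (sub-cong e t) (sub-cong e u)
sub-cong e (jmp t u) = cong₂ jmp (sub-cong (liftS-cong e) t) (sub-cong e u)

liftR-∘ : ∀ {l m n} (ρ : Ren m n) (ρ' : Ren l m) → liftR ρ ∘ liftR ρ' ≗ liftR (ρ ∘ ρ')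
liftR-∘ ρ ρ' zero    = refl
liftR-∘ ρ ρ' (suc i) = refl

ren-ren : ∀ {l m n} (ρ : Ren m n) (ρ' : Ren l m) t → ren ρ (ren ρ' t) ≡ ren (ρ ∘ ρ') t
ren-ren ρ ρ' (var i)   = refl
ren-ren ρ ρ' (lam t)   =
  cong lam (trans (ren-ren (liftR ρ) (liftR ρ') t) (ren-cong (liftR-∘ ρ ρ') t))
ren-ren ρ ρ' (app t u) = cong₂ app (ren-ren ρ ρ' t) (ren-ren ρ ρ' u)
ren-ren ρ ρ' (jmp t u) =
  cong₂ jmp (trans (ren-ren (liftR ρ) (liftR ρ') t) (ren-cong (liftR-∘ ρ ρ') t)) (ren-ren ρ ρ' u)

weaken-ren : ∀ {m n} (ρ : Ren m n) u → ren (liftR ρ) (weaken u) ≡ weaken (ren ρ u)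
weaken-ren ρ u = trans (ren-ren (liftR ρ) suc u) (sym (ren-ren suc ρ u))

ren-liftS : ∀ {l m n} (ρ : Ren m n) (σ : Sub l m) → ren (liftR ρ) ∘ liftS σ ≗ liftS (ren ρ ∘ σ)
ren-liftS ρ σ zero    = refl
ren-liftS ρ σ (suc i) = weaken-ren ρ (σ i)

ren-sub : ∀ {l m n} (ρ : Ren m n) (σ : Sub l m) t → ren ρ (sub σ t) ≡ sub (ren ρ ∘ σ) t
ren-sub ρ σ (var i)   = refl
ren-sub ρ σ (lam t)   =
  cong lam (trans (ren-sub (liftR ρ) (liftS σ) t) (sub-cong (ren-liftS ρ σ) t))
ren-sub ρ σ (app t u) = cong₂ app (ren-sub ρ σ t) (ren-sub ρ σ u)
ren-sub ρ σ (jmp t u) =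
  cong₂ jmp (trans (ren-sub (liftR ρ) (liftS σ) t) (sub-cong (ren-liftS ρ σ) t)) (ren-sub ρ σ u)

liftS-liftR : ∀ {l m n} (σ : Sub m n) (ρ : Ren l m) → liftS σ ∘ liftR ρ ≗ liftS (σ ∘ ρ)
liftS-liftR σ ρ zero    = refl
liftS-liftR σ ρ (suc i) = refl

sub-ren : ∀ {l m n} (σ : Sub m n) (ρ : Ren l m) t → sub σ (ren ρ t) ≡ sub (σ ∘ ρ) t
sub-ren σ ρ (var i)   = refl
sub-ren σ ρ (lam t)   =
  cong lam (trans (sub-ren (liftS σ) (liftR ρ) t) (sub-cong (liftS-liftR σ ρ) t))
sub-ren σ ρ (app t u) = cong₂ app (sub-ren σ ρ t) (sub-ren σ ρ u)
sub-ren σ ρ (jmp t u) =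
  cong₂ jmp (trans (sub-ren (liftS σ) (liftR ρ) t) (sub-cong (liftS-liftR σ ρ) t)) (sub-ren σ ρ u)

weaken-sub : ∀ {m n} (σ : Sub m n) u → sub (liftS σ) (weaken u) ≡ weaken (sub σ u)
weaken-sub σ u = trans (sub-ren (liftS σ) suc u) (sym (ren-sub suc σ u))

sub-liftS : ∀ {l m n} (σ : Sub m n) (τ : Sub l m) → sub (liftS σ) ∘ liftS τ ≗ liftS (sub σ ∘ τ)
sub-liftS σ τ zero    = refl
sub-liftS σ τ (suc i) = weaken-sub σ (τ i)

sub-sub : ∀ {l m n} (σ : Sub m n) (τ : Sub l m) t → sub σ (sub τ t) ≡ sub (sub σ ∘ τ) t
sub-sub σ τ (var i)   = refl
sub-sub σ τ (lam t)   =
  cong lam (trans (sub-sub (liftS σ) (liftS τ) t) (sub-cong (sub-liftS σ τ) t))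
sub-sub σ τ (app t u) = cong₂ app (sub-sub σ τ t) (sub-sub σ τ u)
sub-sub σ τ (jmp t u) =
  cong₂ jmp (trans (sub-sub (liftS σ) (liftS τ) t) (sub-cong (sub-liftS σ τ) t)) (sub-sub σ τ u)

liftS-var : ∀ {m n} (ρ : Ren m n) → liftS (var ∘ ρ) ≗ var ∘ liftR ρ
liftS-var ρ zero    = refl
liftS-var ρ (suc i) = refl

ren-as-sub : ∀ {m n} (ρ : Ren m n) t → ren ρ t ≡ sub (var ∘ ρ) t
ren-as-sub ρ (var i)   = refl
ren-as-sub ρ (lam t)   =
  cong lam (trans (ren-as-sub (liftR ρ) t) (sym (sub-cong (liftS-var ρ) t)))
ren-as-sub ρ (app t u) = cong₂ app (ren-as-sub ρ t) (ren-as-sub ρ u)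
ren-as-sub ρ (jmp t u) =
  cong₂ jmp (trans (ren-as-sub (liftR ρ) t) (sym (sub-cong (liftS-var ρ) t))) (ren-as-sub ρ u)

liftS-id : ∀ {n} → liftS {n} var ≗ var
liftS-id zero    = refl
liftS-id (suc i) = refl

sub-var : ∀ {n} (t : Tm n) → sub var t ≡ t
sub-var (var i)   = refl
sub-var (lam t)   = cong lam (trans (sub-cong liftS-id t) (sub-var t))
sub-var (app t u) = cong₂ app (sub-var t) (sub-var u)
sub-var (jmp t u) = cong₂ jmp (trans (sub-cong liftS-id t) (sub-var t)) (sub-var u)

ren-id : ∀ {n} (t : Tm n) → ren id t ≡ t
ren-id t = trans (ren-as-sub id t) (sub-var t)

sub0-weaken : ∀ {n} (u : Tm n) v → sub (sub0 u) (weaken v) ≡ v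
sub0-weaken u v = trans (sub-ren (sub0 u) suc v) (sub-var v)

sub-[]₀ : ∀ {m n} (σ : Sub m n) t u → sub σ (t [ u ]₀) ≡ sub (liftS σ) t [ sub σ u ]₀
sub-[]₀ σ t u =
  trans (sub-sub σ (sub0 u) t)
        (trans (sub-cong pointwise t) (sym (sub-sub (sub0 (sub σ u)) (liftS σ) t)))
  where
  pointwise : sub σ ∘ sub0 u ≗ sub (sub0 (sub σ u)) ∘ liftS σ
  pointwise zero    = refl
  pointwise (suc i) = sym (sub0-weaken (sub σ u) (σ i))

ren-[]₀ : ∀ {m n} (ρ : Ren m n) t u → ren ρ (t [ u ]₀) ≡ ren (liftR ρ) t [ ren ρ u ]₀
ren-[]₀ ρ t u =
  trans (ren-sub ρ (sub0 u) t)
        (trans (sub-cong pointwise t) (sym (sub-ren (sub0 (ren ρ u)) (liftR ρ) t)))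
  where
  pointwise : ren ρ ∘ sub0 u ≗ sub0 (ren ρ u) ∘ liftR ρ
  pointwise zero    = refl
  pointwise (suc i) = refl

merge-sub : ∀ {m n} (σ : Sub m n) s →
  ren merge (sub (liftS (liftS σ)) s) ≡ sub (liftS σ) (ren merge s)
merge-sub σ s =
  trans (ren-sub merge (liftS (liftS σ)) s)
        (trans (sub-cong pointwise s) (sym (sub-ren (liftS σ) merge s)))
  where
  pointwise : ren merge ∘ liftS (liftS σ) ≗ liftS σ ∘ merge
  pointwise zero          = refl
  pointwise (suc zero)    = refl
  pointwise (suc (suc i)) = trans (ren-ren merge suc (weaken (σ i))) (ren-ren _ suc (σ i))

occ-var-≡ : ∀ {n} (i : Fin n) → occ i (var i) ≡ 1
occ-var-≡ i with i ≟ i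
... | yes _  = refl
... | no i≢i = ⊥-elim (i≢i refl)

occ-var-≢ : ∀ {n} {i j : Fin n} → i ≢ j → occ i (var j) ≡ 0
occ-var-≢ {i = i} {j} i≢j with i ≟ j
... | yes i≡j = ⊥-elim (i≢j i≡j)
... | no _    = refl

occ-var-injective : ∀ {m n} {ρ : Ren m n} → Injective _≡_ _≡_ ρ →
  ∀ i j → occ (ρ i) (var (ρ j)) ≡ occ i (var j)
occ-var-injective {ρ = ρ} ρ-inj i j = by-cases (i ≟ j)
  where
  by-cases : Dec (i ≡ j) → occ (ρ i) (var (ρ j)) ≡ occ i (var j)
  by-cases (yes refl) = trans (occ-var-≡ (ρ i)) (sym (occ-var-≡ i))
  by-cases (no i≢j)   = trans (occ-var-≢ (i≢j ∘ ρ-inj)) (sym (occ-var-≢ i≢j))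

occ-var-suc : ∀ {n} (i j : Fin n) → occ (suc i) (var (suc j)) ≡ occ i (var j)
occ-var-suc = occ-var-injective suc-injective

liftR-injective : ∀ {m n} {ρ : Ren m n} → Injective _≡_ _≡_ ρ → Injective _≡_ _≡_ (liftR ρ)
liftR-injective ρ-inj {zero}  {zero}  _  = refl
liftR-injective ρ-inj {suc i} {suc j} eq = cong suc (ρ-inj (suc-injective eq))

occ-ren : ∀ {m n} {ρ : Ren m n} → Injective _≡_ _≡_ ρ → ∀ i t → occ (ρ i) (ren ρ t) ≡ occ i t
occ-ren ρ-inj i (var j)   = occ-var-injective ρ-inj i j
occ-ren ρ-inj i (lam t)   = occ-ren (liftR-injective ρ-inj) (suc i) t
occ-ren ρ-inj i (app t u) = cong₂ _+_ (occ-ren ρ-inj i t) (occ-ren ρ-inj i u)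
occ-ren ρ-inj i (jmp t u) =
  cong₂ _+_ (occ-ren (liftR-injective ρ-inj) (suc i) t) (occ-ren ρ-inj i u)

occ-weaken : ∀ {n} i (t : Tm n) → occ (suc i) (weaken t) ≡ occ i t
occ-weaken = occ-ren suc-injective

liftR-∉ : ∀ {m n} {ρ : Ren m n} {i} → (∀ j → ρ j ≢ i) → ∀ j → liftR ρ j ≢ suc i
liftR-∉ i∉ρ zero    ()
liftR-∉ i∉ρ (suc j) eq = i∉ρ j (suc-injective eq)

occ-ren-∉ : ∀ {m n} {ρ : Ren m n} {i} → (∀ j → ρ j ≢ i) → ∀ t → occ i (ren ρ t) ≡ 0
occ-ren-∉ i∉ρ (var j)   = occ-var-≢ (i∉ρ j ∘ sym)
occ-ren-∉ i∉ρ (lam t)   = occ-ren-∉ (liftR-∉ i∉ρ) t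
occ-ren-∉ i∉ρ (app t u) = cong₂ _+_ (occ-ren-∉ i∉ρ t) (occ-ren-∉ i∉ρ u)
occ-ren-∉ i∉ρ (jmp t u) = cong₂ _+_ (occ-ren-∉ (liftR-∉ i∉ρ) t) (occ-ren-∉ i∉ρ u)

occ-weaken-zero : ∀ {n} (t : Tm n) → occ zero (weaken t) ≡ 0
occ-weaken-zero = occ-ren-∉ λ _ ()

Carries : ∀ {m n} → Sub m n → Fin m → Fin n → Set
Carries σ i₀ i = ∀ j → occ i (σ j) ≡ occ i₀ (var j)

liftS-carries : ∀ {m n} {σ : Sub m n} {i₀ i} → Carries σ i₀ i → Carries (liftS σ) (suc i₀) (suc i)
liftS-carries σ-carries zero    = refl
liftS-carries {σ = σ} {i₀} {i} σ-carries (suc j) =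
  trans (occ-weaken i (σ j)) (trans (σ-carries j) (sym (occ-var-suc i₀ j)))

liftS-carries-zero : ∀ {m n} (σ : Sub m n) → Carries (liftS σ) zero zero
liftS-carries-zero σ zero    = refl
liftS-carries-zero σ (suc j) = occ-weaken-zero (σ j)

occ-sub : ∀ {m n} {σ : Sub m n} {i₀ i} → Carries σ i₀ i → ∀ t → occ i (sub σ t) ≡ occ i₀ t
occ-sub σ-carries (var j)   = σ-carries j
occ-sub σ-carries (lam t)   = occ-sub (liftS-carries σ-carries) t
occ-sub σ-carries (app t u) = cong₂ _+_ (occ-sub σ-carries t) (occ-sub σ-carries u)
occ-sub σ-carries (jmp t u) =
  cong₂ _+_ (occ-sub (liftS-carries σ-carries) t) (occ-sub σ-carries u)

Merges : ∀ {m n} → Sub m n → Fin m → Fin m → Fin n → Set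
Merges σ i₁ i₂ i = ∀ j → occ i (σ j) ≡ occ i₁ (var j) + occ i₂ (var j)

liftS-merges : ∀ {m n} {σ : Sub m n} {i₁ i₂ i} →
  Merges σ i₁ i₂ i → Merges (liftS σ) (suc i₁) (suc i₂) (suc i)
liftS-merges σ-merges zero    = refl
liftS-merges {σ = σ} {i₁} {i₂} {i} σ-merges (suc j) =
  trans (occ-weaken i (σ j))
        (trans (σ-merges j) (sym (cong₂ _+_ (occ-var-suc i₁ j) (occ-var-suc i₂ j))))

occ-sub-merges : ∀ {m n} {σ : Sub m n} {i₁ i₂ i} → Merges σ i₁ i₂ i →
  ∀ t → occ i (sub σ t) ≡ occ i₁ t + occ i₂ t
occ-sub-merges σ-merges (var j)   = σ-merges j
occ-sub-merges σ-merges (lam t)   = occ-sub-merges (liftS-merges σ-merges) t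
occ-sub-merges {i₁ = i₁} {i₂} σ-merges (app t u) =
  trans (cong₂ _+_ (occ-sub-merges σ-merges t) (occ-sub-merges σ-merges u))
        (+-interchange (occ i₁ t) (occ i₂ t) (occ i₁ u) (occ i₂ u))
occ-sub-merges {i₁ = i₁} {i₂} σ-merges (jmp t u) =
  trans (cong₂ _+_ (occ-sub-merges (liftS-merges σ-merges) t) (occ-sub-merges σ-merges u))
        (+-interchange (occ (suc i₁) t) (occ (suc i₂) t) (occ i₁ u) (occ i₂ u))

sub-plug : ∀ {n n' m} (σ : Sub n n') (L : JL n m) →
  Σ ℕ λ m' → Σ (JL n' m') λ L' → Σ (Sub m m') λ σ' →
    (∀ t → sub σ (plug L t) ≡ plug L' (sub σ' t)) × (∀ u → sub σ' (wkL L u) ≡ wkL L' (sub σ u))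
sub-plug σ []      = _ , [] , σ , (λ _ → refl) , (λ _ → refl)
sub-plug σ (a ∷ L) with sub-plug (liftS σ) L
... | m' , L' , σ' , plug≡ , wkL≡ =
  m' , sub σ a ∷ L' , σ' , (λ t → cong₂ jmp (plug≡ t) refl) ,
  (λ u → trans (wkL≡ (weaken u)) (cong (wkL L') (weaken-sub σ u)))

sub-↦ : ∀ {n n'} (σ : Sub n n') {t t'} → t ↦ t' → sub σ t ⟶ sub σ t'
sub-↦ σ (dB t L u) with sub-plug σ L
... | _ , L' , σ' , plug≡ , wkL≡ =
  subst₂ _⟶_ (cong₂ app (sym (plug≡ (lam t))) refl)
             (sym (trans (plug≡ _) (cong (plug L' ∘ jmp _) (wkL≡ u))))
         (root (dB (sub (liftS σ') t) L' (sub σ u)))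
sub-↦ σ (w t u occ≡0) rewrite sub-[]₀ σ t u =
  root (w (sub (liftS σ) t) (sub σ u) (trans (occ-sub (liftS-carries-zero σ) t) occ≡0))
sub-↦ σ (d t u occ≡1) rewrite sub-[]₀ σ t u =
  root (d (sub (liftS σ) t) (sub σ u) (trans (occ-sub (liftS-carries-zero σ) t) occ≡1))
sub-↦ σ (c t u 1<occ s s-renames) rewrite weaken-sub σ u =
  root (c (sub (liftS σ) t) (sub σ u)
          (subst (1 <_) (sym (occ-sub (liftS-carries-zero σ) t)) 1<occ)
          (sub (liftS (liftS σ)) s)
          record
            { collapse = trans (merge-sub σ s) (cong (sub (liftS σ)) collapse)
            ; someY    = subst (1 ≤_) (sym (occ-sub (liftS-carries (liftS-carries-zero σ)) s)) someY
            ; someX    = subst (1 ≤_) (sym (occ-sub (liftS-carries-zero (liftS σ)) s)) someX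
            })
  where open Renamed s-renames

sub-⟶ : ∀ {n n'} (σ : Sub n n') {t t'} → t ⟶ t' → sub σ t ⟶ sub σ t'
sub-⟶ σ (root r) = sub-↦ σ r
sub-⟶ σ (lamC s) = lamC (sub-⟶ (liftS σ) s)
sub-⟶ σ (appL s) = appL (sub-⟶ σ s)
sub-⟶ σ (appR s) = appR (sub-⟶ σ s)
sub-⟶ σ (jmpL s) = jmpL (sub-⟶ (liftS σ) s)
sub-⟶ σ (jmpR s) = jmpR (sub-⟶ σ s)

ren-⟶ : ∀ {n n'} (ρ : Ren n n') {t t'} → t ⟶ t' → ren ρ t ⟶ ren ρ t'
ren-⟶ ρ {t} {t'} s = subst₂ _⟶_ (sym (ren-as-sub ρ t)) (sym (ren-as-sub ρ t')) (sub-⟶ (var ∘ ρ) s)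

infix 4 _⟶*_ _⟶⁺_

_⟶*_ : ∀ {n} → Tm n → Tm n → Set
_⟶*_ = Star _⟶_

_⟶⁺_ : ∀ {n} → Tm n → Tm n → Set
_⟶⁺_ = TransClosure _⟶_

liftS-⟶* : ∀ {m n} {σ σ' : Sub m n} → (∀ j → σ j ⟶* σ' j) → ∀ j → liftS σ j ⟶* liftS σ' j
liftS-⟶* σ⟶*σ' zero    = ε
liftS-⟶* σ⟶*σ' (suc j) = gmap weaken (ren-⟶ suc) (σ⟶*σ' j)

sub-⟶* : ∀ {m n} {σ σ' : Sub m n} → (∀ j → σ j ⟶* σ' j) → ∀ t → sub σ t ⟶* sub σ' t
sub-⟶* σ⟶*σ' (var i)   = σ⟶*σ' i
sub-⟶* σ⟶*σ' (lam t)   = gmap lam lamC (sub-⟶* (liftS-⟶* σ⟶*σ') t)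
sub-⟶* {σ = σ} {σ'} σ⟶*σ' (app t u) =
  gmap (λ t₀ → app t₀ (sub σ u)) appL (sub-⟶* σ⟶*σ' t) ◅◅ gmap (app (sub σ' t)) appR (sub-⟶* σ⟶*σ' u)
sub-⟶* {σ = σ} {σ'} σ⟶*σ' (jmp t u) =
  gmap (λ t₀ → jmp t₀ (sub σ u)) jmpL (sub-⟶* (liftS-⟶* σ⟶*σ') t)
    ◅◅ gmap (jmp (sub (liftS σ') t)) jmpR (sub-⟶* σ⟶*σ' u)

-- Reflecting steps along injective renamings

WeakPullback : ∀ {a b c d} → Ren a c → Ren b c → Ren d a → Ren d b → Set
WeakPullback f g g' f' = ∀ i j → f i ≡ g j → ∃ λ k → i ≡ g' k × f' k ≡ j

liftR-weakPullback : ∀ {a b c d} {f : Ren a c} {g : Ren b c} {g' : Ren d a} {f' : Ren d b} →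
  WeakPullback f g g' f' → WeakPullback (liftR f) (liftR g) (liftR g') (liftR f')
liftR-weakPullback pb zero    zero    _  = zero , refl , refl
liftR-weakPullback pb (suc i) (suc j) eq with pb i j (suc-injective eq)
... | k , i≡ , j≡ = suc k , cong suc i≡ , cong suc j≡

ren-weakPullback : ∀ {a b c d} {f : Ren a c} {g : Ren b c} {g' : Ren d a} {f' : Ren d b} →
  WeakPullback f g g' f' → ∀ s t → ren f s ≡ ren g t → ∃ λ s₀ → s ≡ ren g' s₀ × ren f' s₀ ≡ t
ren-weakPullback pb (var i) (var j) eq with pb i j (var-injective eq)
... | k , i≡ , j≡ = var k , cong var i≡ , cong var j≡
ren-weakPullback pb (lam s) (lam t) eq with ren-weakPullback (liftR-weakPullback pb) s t (lam-injective eq)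
... | s₀ , s≡ , t≡ = lam s₀ , cong lam s≡ , cong lam t≡
ren-weakPullback pb (app s₁ s₂) (app t₁ t₂) eq
  with ren-weakPullback pb s₁ t₁ (app-injectiveˡ eq) | ren-weakPullback pb s₂ t₂ (app-injectiveʳ eq)
... | s₀₁ , s₁≡ , t₁≡ | s₀₂ , s₂≡ , t₂≡ = app s₀₁ s₀₂ , cong₂ app s₁≡ s₂≡ , cong₂ app t₁≡ t₂≡
ren-weakPullback pb (jmp s₁ s₂) (jmp t₁ t₂) eq
  with ren-weakPullback (liftR-weakPullback pb) s₁ t₁ (jmp-injectiveˡ eq)
     | ren-weakPullback pb s₂ t₂ (jmp-injectiveʳ eq)
... | s₀₁ , s₁≡ , t₁≡ | s₀₂ , s₂≡ , t₂≡ = jmp s₀₁ s₀₂ , cong₂ jmp s₁≡ s₂≡ , cong₂ jmp t₁≡ t₂≡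
ren-weakPullback pb (var _)   (lam _)   ()
ren-weakPullback pb (var _)   (app _ _) ()
ren-weakPullback pb (var _)   (jmp _ _) ()
ren-weakPullback pb (lam _)   (var _)   ()
ren-weakPullback pb (lam _)   (app _ _) ()
ren-weakPullback pb (lam _)   (jmp _ _) ()
ren-weakPullback pb (app _ _) (var _)   ()
ren-weakPullback pb (app _ _) (lam _)   ()
ren-weakPullback pb (app _ _) (jmp _ _) ()
ren-weakPullback pb (jmp _ _) (var _)   ()
ren-weakPullback pb (jmp _ _) (lam _)   ()
ren-weakPullback pb (jmp _ _) (app _ _) ()

merge-weakPullback : ∀ {m n} (ρ : Ren m n) → WeakPullback merge (liftR ρ) (liftR (liftR ρ)) merge
merge-weakPullback ρ zero          zero    _  = zero , refl , refl
merge-weakPullback ρ (suc zero)    zero    _  = suc zero , refl , refl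
merge-weakPullback ρ (suc (suc i)) (suc j) eq = suc (suc j) , cong (λ k → suc (suc k)) (suc-injective eq) , refl

ren-plug-lam-inv : ∀ {n n' m} (ρ : Ren n n') (L : JL n' m) (s : Tm (suc m)) t →
  plug L (lam s) ≡ ren ρ t →
  Σ ℕ λ m₀ → Σ (JL n m₀) λ L₀ → Σ (Tm (suc m₀)) λ s₀ → t ≡ plug L₀ (lam s₀) ×
    (∀ u → plug L (jmp s (wkL L (ren ρ u))) ≡ ren ρ (plug L₀ (jmp s₀ (wkL L₀ u))))
ren-plug-lam-inv ρ []      s (lam t)   eq = _ , [] , t , refl , λ _ → cong₂ jmp (lam-injective eq) refl
ren-plug-lam-inv ρ (a ∷ L) s (jmp t b) eq with ren-plug-lam-inv (liftR ρ) L s t (jmp-injectiveˡ eq)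
... | m₀ , L₀ , s₀ , t≡ , jmp≡ =
  m₀ , b ∷ L₀ , s₀ , cong₂ jmp t≡ refl ,
  λ u → cong₂ jmp (trans (cong (λ v → plug L (jmp s (wkL L v))) (sym (weaken-ren ρ u))) (jmp≡ (weaken u)))
                  (jmp-injectiveʳ eq)
ren-plug-lam-inv ρ []      s (var _)   ()
ren-plug-lam-inv ρ []      s (app _ _) ()
ren-plug-lam-inv ρ []      s (jmp _ _) ()
ren-plug-lam-inv ρ (_ ∷ _) s (var _)   ()
ren-plug-lam-inv ρ (_ ∷ _) s (lam _)   ()
ren-plug-lam-inv ρ (_ ∷ _) s (app _ _) ()

ren-↦-inv : ∀ {n n'} {ρ : Ren n n'} → Injective _≡_ _≡_ ρ → ∀ {X r} → X ↦ r →
  ∀ t → X ≡ ren ρ t → ∃ λ t' → t ⟶ t' × r ≡ ren ρ t'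
ren-↦-inv {ρ = ρ} ρ-inj (dB s L u) (app t v) eq
  with ren-plug-lam-inv ρ L s t (app-injectiveˡ eq)
... | _ , L₀ , s₀ , refl , jmp≡ rewrite app-injectiveʳ eq = _ , root (dB s₀ L₀ v) , jmp≡ v
ren-↦-inv {ρ = ρ} ρ-inj (w _ _ occ≡0) (jmp t u) refl =
  _ , root (w t u (trans (sym (occ-ren (liftR-injective ρ-inj) zero t)) occ≡0)) , sym (ren-[]₀ ρ t u)
ren-↦-inv {ρ = ρ} ρ-inj (d _ _ occ≡1) (jmp t u) refl =
  _ , root (d t u (trans (sym (occ-ren (liftR-injective ρ-inj) zero t)) occ≡1)) , sym (ren-[]₀ ρ t u)
ren-↦-inv {ρ = ρ} ρ-inj (c _ _ 1<occ s s-renames) (jmp t u) refl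
  with ren-weakPullback (merge-weakPullback ρ) s t (Renamed.collapse s-renames)
... | s₀ , refl , collapse₀ =
  _ , root (c t u (subst (1 <_) (occ-ren ρ⁺-inj zero t) 1<occ) s₀
               record { collapse = collapse₀
                      ; someY    = subst (1 ≤_) (occ-ren ρ⁺⁺-inj (suc zero) s₀) someY
                      ; someX    = subst (1 ≤_) (occ-ren ρ⁺⁺-inj zero s₀) someX }) ,
  cong₂ jmp (cong₂ jmp refl (sym (weaken-ren ρ u))) refl
  where
  open Renamed s-renames
  ρ⁺-inj  = liftR-injective ρ-inj
  ρ⁺⁺-inj = liftR-injective ρ⁺-inj
ren-↦-inv ρ-inj (dB _ _ _)      (var _)   ()
ren-↦-inv ρ-inj (dB _ _ _)      (lam _)   ()
ren-↦-inv ρ-inj (dB _ _ _)      (jmp _ _) ()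
ren-↦-inv ρ-inj (w _ _ _)       (var _)   ()
ren-↦-inv ρ-inj (w _ _ _)       (lam _)   ()
ren-↦-inv ρ-inj (w _ _ _)       (app _ _) ()
ren-↦-inv ρ-inj (d _ _ _)       (var _)   ()
ren-↦-inv ρ-inj (d _ _ _)       (lam _)   ()
ren-↦-inv ρ-inj (d _ _ _)       (app _ _) ()
ren-↦-inv ρ-inj (c _ _ _ _ _)   (var _)   ()
ren-↦-inv ρ-inj (c _ _ _ _ _)   (lam _)   ()
ren-↦-inv ρ-inj (c _ _ _ _ _)   (app _ _) ()

ren-⟶-inv : ∀ {n n'} {ρ : Ren n n'} → Injective _≡_ _≡_ ρ → ∀ t {r} → ren ρ t ⟶ r →
  ∃ λ t' → t ⟶ t' × r ≡ ren ρ t'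
ren-⟶-inv ρ-inj (var _)       (root ())
ren-⟶-inv ρ-inj (lam _)       (root ())
ren-⟶-inv ρ-inj t@(app _ _)   (root r) = ren-↦-inv ρ-inj r t refl
ren-⟶-inv ρ-inj t@(jmp _ _)   (root r) = ren-↦-inv ρ-inj r t refl
ren-⟶-inv ρ-inj (lam t)     (lamC s) with ren-⟶-inv (liftR-injective ρ-inj) t s
... | t' , s' , refl = lam t' , lamC s' , refl
ren-⟶-inv ρ-inj (app t u)   (appL s) with ren-⟶-inv ρ-inj t s
... | t' , s' , refl = app t' u , appL s' , refl
ren-⟶-inv ρ-inj (app t u)   (appR s) with ren-⟶-inv ρ-inj u s
... | u' , s' , refl = app t u' , appR s' , refl
ren-⟶-inv ρ-inj (jmp t u)   (jmpL s) with ren-⟶-inv (liftR-injective ρ-inj) t s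
... | t' , s' , refl = jmp t' u , jmpL s' , refl
ren-⟶-inv ρ-inj (jmp t u)   (jmpR s) with ren-⟶-inv ρ-inj u s
... | u' , s' , refl = jmp t u' , jmpR s' , refl

-- Stacks of jumps

-- n ⊕ k is k + n, accumulated so that the scope under one more jump unfolds definitionally.
_⊕_ : ℕ → ℕ → ℕ
n ⊕ zero  = n
n ⊕ suc k = suc n ⊕ k

sucR : ∀ {m n} → Ren m n → Ren m (suc n)
sucR ρ i = suc (ρ i)

raiseR : ∀ {n} k → Ren n (n ⊕ k)
raiseR zero    i = i
raiseR (suc k) i = raiseR k (suc i)

liftsS : ∀ {m n} k → Sub m n → Sub (m ⊕ k) (n ⊕ k)
liftsS zero    σ = σ
liftsS (suc k) σ = liftsS k (liftS σ)

weakens : ∀ {n} k → Tm n → Tm (n ⊕ k)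
weakens zero    v = v
weakens (suc k) v = weakens k (weaken v)

-- The stack  t[x₁/u₁]…[xₖ/uₖ]  (x₁ outermost), whose arguments all live in an outer scope n₀
-- embedded by ρ, so that no xᵢ is free in any uⱼ.
jumps : ∀ {n₀ n} → Ren n₀ n → (us : List (Tm n₀)) → Tm (n ⊕ length us) → Tm n
jumps ρ []       t = t
jumps ρ (u ∷ us) t = jmp (jumps (sucR ρ) us t) (ren ρ u)

extend : ∀ {n n₀} → Sub n n₀ → Tm n₀ → Sub (suc n) n₀
extend τ u zero    = u
extend τ u (suc i) = τ i

jumpSub : ∀ {n₀ n} → Sub n n₀ → (us : List (Tm n₀)) → Sub (n ⊕ length us) n₀
jumpSub τ []       = τ
jumpSub τ (u ∷ us) = jumpSub (extend τ u) us

-- w 0 = 1 and w k = 2k - 1: every jump weighs at least 1, and splitting k = k₁ + k₂ with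
-- k₁, k₂ ≥ 1 lowers 2k - 1 to 2k - 2.
occWeight : ℕ → ℕ
occWeight zero    = 1
occWeight (suc k) = suc (k + k)

stackWeight : ∀ {n₀} n (us : List (Tm n₀)) → Tm (n ⊕ length us) → ℕ
stackWeight n []       t = 0
stackWeight n (u ∷ us) t = occWeight (occ (raiseR (length us) zero) t) + stackWeight (suc n) us t

occWeight-split : ∀ k₁ k₂ M → 1 ≤ k₁ → 1 ≤ k₂ →
  occWeight k₂ + (occWeight k₁ + M) < occWeight (k₁ + k₂) + M
occWeight-split (suc k₁) (suc k₂) M _ _ = ≤-reflexive (arith k₁ k₂ M)
  where
  arith : ∀ k₁ k₂ M →
    suc (suc (k₂ + k₂) + (suc (k₁ + k₁) + M)) ≡ suc ((k₁ + suc k₂) + (k₁ + suc k₂)) + M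
  arith = solve-∀

liftsS-cong : ∀ {m n} k {σ σ' : Sub m n} → σ ≗ σ' → liftsS k σ ≗ liftsS k σ'
liftsS-cong zero    e = e
liftsS-cong (suc k) e = liftsS-cong k (liftS-cong e)

jumpSub-cong : ∀ {n₀ n} (us : List (Tm n₀)) {τ τ' : Sub n n₀} → τ ≗ τ' → jumpSub τ us ≗ jumpSub τ' us
jumpSub-cong []       e = e
jumpSub-cong (u ∷ us) e = jumpSub-cong us λ { zero → refl ; (suc i) → e i }

jumpSub-liftsS : ∀ {n₀ n m} (us : List (Tm n₀)) (τ : Sub n n₀) (σ : Sub m n) →
  sub (jumpSub τ us) ∘ liftsS (length us) σ ≗ jumpSub (sub τ ∘ σ) us
jumpSub-liftsS []       τ σ j = refl
jumpSub-liftsS (u ∷ us) τ σ j =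
  trans (jumpSub-liftsS us (extend τ u) (liftS σ) j) (jumpSub-cong us pointwise j)
  where
  pointwise : sub (extend τ u) ∘ liftS σ ≗ extend (sub τ ∘ σ) u
  pointwise zero    = refl
  pointwise (suc i) = sub-ren (extend τ u) suc (σ i)

jumpSub-weakens : ∀ {n₀ n} (us : List (Tm n₀)) (τ : Sub n n₀) v →
  sub (jumpSub τ us) (weakens (length us) v) ≡ sub τ v
jumpSub-weakens []       τ v = refl
jumpSub-weakens (u ∷ us) τ v = trans (jumpSub-weakens us (extend τ u) (weaken v)) (sub-ren (extend τ u) suc v)

jumpSub-⟶* : ∀ {n₀ n} (us : List (Tm n₀)) {τ τ' : Sub n n₀} →
  (∀ j → τ j ⟶* τ' j) → ∀ j → jumpSub τ us j ⟶* jumpSub τ' us j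
jumpSub-⟶* []       τ⟶*τ' = τ⟶*τ'
jumpSub-⟶* (u ∷ us) τ⟶*τ' = jumpSub-⟶* us λ { zero → ε ; (suc i) → τ⟶*τ' i }

sub-jumps : ∀ {n₀ n n'} (σ : Sub n n') (ρ : Ren n₀ n) (ρ' : Ren n₀ n') → σ ∘ ρ ≗ var ∘ ρ' →
  ∀ us t → sub σ (jumps ρ us t) ≡ jumps ρ' us (sub (liftsS (length us) σ) t)
sub-jumps σ ρ ρ' σρ≗ρ' []       t = refl
sub-jumps σ ρ ρ' σρ≗ρ' (u ∷ us) t =
  cong₂ jmp (sub-jumps (liftS σ) (sucR ρ) (sucR ρ') (cong weaken ∘ σρ≗ρ') us t)
            (trans (sub-ren σ ρ u) (trans (sub-cong σρ≗ρ' u) (sym (ren-as-sub ρ' u))))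

occ-jumps : ∀ {n₀ n} {ρ : Ren n₀ n} {i} → (∀ j → ρ j ≢ i) →
  ∀ us t → occ i (jumps ρ us t) ≡ occ (raiseR (length us) i) t
occ-jumps i∉ρ []       t = refl
occ-jumps i∉ρ (u ∷ us) t =
  trans (cong₂ _+_ (occ-jumps (λ j → i∉ρ j ∘ suc-injective) us t) (occ-ren-∉ i∉ρ u)) (+-identityʳ _)

liftsS-carries : ∀ {m n} k {σ : Sub m n} {i₀ i} → Carries σ i₀ i →
  Carries (liftsS k σ) (raiseR k i₀) (raiseR k i)
liftsS-carries zero    σ-carries = σ-carries
liftsS-carries (suc k) σ-carries = liftsS-carries k (liftS-carries σ-carries)

liftsS-merges : ∀ {m n} k {σ : Sub m n} {i₁ i₂ i} → Merges σ i₁ i₂ i →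
  Merges (liftsS k σ) (raiseR k i₁) (raiseR k i₂) (raiseR k i)
liftsS-merges zero    σ-merges = σ-merges
liftsS-merges (suc k) σ-merges = liftsS-merges k (liftS-merges σ-merges)

stackWeight-liftsS : ∀ {n₀ m m'} (us : List (Tm n₀)) (σ : Sub m m') t →
  stackWeight m' us (sub (liftsS (length us) σ) t) ≡ stackWeight m us t
stackWeight-liftsS []       σ t = refl
stackWeight-liftsS (u ∷ us) σ t =
  cong₂ _+_ (cong occWeight (occ-sub (liftsS-carries (length us) (liftS-carries-zero σ)) t))
            (stackWeight-liftsS us (liftS σ) t)

data StackStep {n₀} : ∀ {n} → Ren n₀ n → (us : List (Tm n₀)) → Tm (n ⊕ length us) →
                      (us' : List (Tm n₀)) → Tm (n ⊕ length us') → Set where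
  body   : ∀ {n} {ρ : Ren n₀ n} {us t t'} → t ⟶ t' → StackStep ρ us t us t'
  arg    : ∀ {n} {ρ : Ren n₀ n} {u u' us t} → u ⟶ u' → StackStep ρ (u ∷ us) t (u' ∷ us) t
  deeper : ∀ {n} {ρ : Ren n₀ n} {u us t us' t'} →
           StackStep (sucR ρ) us t us' t' → StackStep ρ (u ∷ us) t (u ∷ us') t'
  -- A w or d step.
  erase  : ∀ {n} {ρ : Ren n₀ n} {u us t} →
           StackStep ρ (u ∷ us) t us (sub (liftsS (length us) (sub0 (ren ρ u))) t)
  copy   : ∀ {n} {ρ : Ren n₀ n} {u us t} (t' : Tm (suc (suc n) ⊕ length us)) →
           t ≡ sub (liftsS (length us) (var ∘ merge)) t' →
           1 ≤ occ (raiseR (length us) zero) t' →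
           1 ≤ occ (raiseR (length us) (suc zero)) t' →
           StackStep ρ (u ∷ us) t (u ∷ u ∷ us) t'

sucR-weakPullback : ∀ {a c n₀} {f : Ren a c} {ρ₁ : Ren n₀ c} {ρ₂ : Ren n₀ a} →
  WeakPullback f ρ₁ ρ₂ id → WeakPullback (liftR f) (sucR ρ₁) (sucR ρ₂) id
sucR-weakPullback pb (suc i) j eq with pb i j (suc-injective eq)
... | k , i≡ , k≡j = k , cong suc i≡ , k≡j

merge-sucR-weakPullback : ∀ {n₀ n} (ρ : Ren n₀ n) → WeakPullback merge (sucR ρ) (sucR (sucR ρ)) id
merge-sucR-weakPullback ρ (suc (suc i)) j eq = j , cong (λ k → suc (suc k)) (suc-injective eq) , refl

ren-jumps-inv : ∀ {a c n₀} {f : Ren a c} {ρ₁ : Ren n₀ c} {ρ₂ : Ren n₀ a} → WeakPullback f ρ₁ ρ₂ id →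
  ∀ us s t → ren f s ≡ jumps ρ₁ us t →
  ∃ λ t' → s ≡ jumps ρ₂ us t' × t ≡ sub (liftsS (length us) (var ∘ f)) t'
ren-jumps-inv {f = f} pb []       s t eq = s , refl , trans (sym eq) (ren-as-sub f s)
ren-jumps-inv {f = f} {ρ₂ = ρ₂} pb (u ∷ us) (jmp s v) t eq
  with ren-jumps-inv (sucR-weakPullback pb) us s t (jmp-injectiveˡ eq)
     | ren-weakPullback pb v u (jmp-injectiveʳ eq)
... | t' , s≡ , t≡ | v₀ , v≡ , u≡ =
  t' , cong₂ jmp s≡ (trans v≡ (cong (ren ρ₂) (trans (sym (ren-id v₀)) u≡))) ,
  trans t≡ (sub-cong (liftsS-cong (length us) (sym ∘ liftS-var f)) t')
ren-jumps-inv pb (_ ∷ _) (var _)   t ()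
ren-jumps-inv pb (_ ∷ _) (lam _)   t ()
ren-jumps-inv pb (_ ∷ _) (app _ _) t ()

jumps-⟶-inv : ∀ {n₀ n} {ρ : Ren n₀ n} → Injective _≡_ _≡_ ρ → ∀ us t {r} → jumps ρ us t ⟶ r →
  ∃ λ us' → Σ (Tm (n ⊕ length us')) λ t' → StackStep ρ us t us' t' × r ≡ jumps ρ us' t'
jumps-⟶-inv ρ-inj []       t s = [] , _ , body s , refl
jumps-⟶-inv ρ-inj (u ∷ us) t (jmpL s) with jumps-⟶-inv (ρ-inj ∘ suc-injective) us t s
... | us' , t' , step , refl = u ∷ us' , t' , deeper step , refl
jumps-⟶-inv ρ-inj (u ∷ us) t (jmpR s) with ren-⟶-inv ρ-inj u s
... | u' , s' , refl = u' ∷ us , t , arg s' , refl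
jumps-⟶-inv {ρ = ρ} ρ-inj (u ∷ us) t (root (w _ _ _)) =
  us , _ , erase , sub-jumps (sub0 (ren ρ u)) (sucR ρ) ρ (λ _ → refl) us t
jumps-⟶-inv {ρ = ρ} ρ-inj (u ∷ us) t (root (d _ _ _)) =
  us , _ , erase , sub-jumps (sub0 (ren ρ u)) (sucR ρ) ρ (λ _ → refl) us t
jumps-⟶-inv {ρ = ρ} ρ-inj (u ∷ us) t (root (c _ _ _ s s-renames))
  with ren-jumps-inv (merge-sucR-weakPullback ρ) us s t collapse
  where open Renamed s-renames
... | t' , refl , t≡ =
  u ∷ u ∷ us , t' ,
  copy t' t≡ (subst (1 ≤_) (occ-jumps (λ _ ()) us t') someX)
             (subst (1 ≤_) (occ-jumps (λ _ ()) us t') someY) ,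
  cong₂ jmp (cong₂ jmp refl (ren-ren suc ρ u)) refl
  where open Renamed s-renames

jumps-plug-lam-inv : ∀ {n₀ n m} (ρ : Ren n₀ n) us t (L : JL n m) s v → jumps ρ us t ≡ plug L (lam s) →
  ∃ λ t' → app t (weakens (length us) v) ⟶ t' × plug L (jmp s (wkL L v)) ≡ jumps ρ us t'
jumps-plug-lam-inv ρ []       t L       s v refl = _ , root (dB s L v) , refl
jumps-plug-lam-inv ρ (u ∷ us) t (a ∷ L) s v eq
  with jumps-plug-lam-inv (sucR ρ) us t L s (weaken v) (jmp-injectiveˡ eq)
... | t' , step , plug≡ = t' , step , cong₂ jmp plug≡ (sym (jmp-injectiveʳ eq))

infix 4 _⟶ₗ_

data _⟶ₗ_ {n} : List (Tm n) → List (Tm n) → Set where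
  here  : ∀ {u u' us} → u ⟶ u' → u ∷ us ⟶ₗ u' ∷ us
  there : ∀ {u us us'} → us ⟶ₗ us' → u ∷ us ⟶ₗ u ∷ us'

⟶*-split : ∀ {n} {a b : Tm n} → a ⟶* b → a ≡ b ⊎ a ⟶⁺ b
⟶*-split ε        = inj₁ refl
⟶*-split (s ◅ ss) = inj₂ (s ◅⁺ ss)
  where
  _◅⁺_ : ∀ {a b c} → a ⟶ b → b ⟶* c → a ⟶⁺ c
  s ◅⁺ ε        = [ s ]
  s ◅⁺ (s' ◅ ss) = s ∷ (s' ◅⁺ ss)

-- The variables outside the image of ρ are those of enclosing jumps, whose weights depend
-- on these counts.
KeepsOuterOccs : ∀ {n₀ n} → Ren n₀ n → (us : List (Tm n₀)) → Tm (n ⊕ length us) →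
                 (us' : List (Tm n₀)) → Tm (n ⊕ length us') → Set
KeepsOuterOccs {n = n} ρ us t us' t' =
  ∀ (i : Fin n) → (∀ j → ρ j ≢ i) → occ (raiseR (length us') i) t' ≡ occ (raiseR (length us) i) t

data Effect {n₀ n} (ρ : Ren n₀ n) (τ : Sub n n₀) (us : List (Tm n₀)) (t : Tm (n ⊕ length us))
            (us' : List (Tm n₀)) (t' : Tm (n ⊕ length us')) : Set where
  reduces  : sub (jumpSub τ us) t ⟶⁺ sub (jumpSub τ us') t' → Effect ρ τ us t us' t'
  lightens : sub (jumpSub τ us') t' ≡ sub (jumpSub τ us) t → stackWeight n us' t' < stackWeight n us t →
             KeepsOuterOccs ρ us t us' t' → Effect ρ τ us t us' t'
  argument : sub (jumpSub τ us') t' ≡ sub (jumpSub τ us) t → stackWeight n us' t' ≡ stackWeight n us t →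
             us ⟶ₗ us' → KeepsOuterOccs ρ us t us' t' → Effect ρ τ us t us' t'

merge-merges : ∀ {n} → Merges {suc (suc n)} (var ∘ merge) zero (suc zero) zero
merge-merges zero          = refl
merge-merges (suc zero)    = refl
merge-merges (suc (suc j)) = refl

module _ {n₀ n} (ρ : Ren n₀ n) (τ : Sub n n₀) (τρ≗var : τ ∘ ρ ≗ var) (u : Tm n₀) (us : List (Tm n₀)) where

  private
    k = length us

  erase-unfolds : ∀ t → sub (jumpSub τ us) (sub (liftsS k (sub0 (ren ρ u))) t) ≡ sub (jumpSub τ (u ∷ us)) t
  erase-unfolds t =
    trans (sub-sub (jumpSub τ us) _ t)
          (sub-cong (λ j → trans (jumpSub-liftsS us τ (sub0 (ren ρ u)) j) (jumpSub-cong us pointwise j)) t)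
    where
    pointwise : sub τ ∘ sub0 (ren ρ u) ≗ extend τ u
    pointwise zero    = trans (sub-ren τ ρ u) (trans (sub-cong τρ≗var u) (sub-var u))
    pointwise (suc i) = refl

  erase-lightens : ∀ t → stackWeight n us (sub (liftsS k (sub0 (ren ρ u))) t) < stackWeight n (u ∷ us) t
  erase-lightens t rewrite stackWeight-liftsS us (sub0 (ren ρ u)) t = occWeight-pos (occ (raiseR k zero) t)
    where
    occWeight-pos : ∀ j → stackWeight (suc n) us t < occWeight j + stackWeight (suc n) us t
    occWeight-pos zero    = s≤s (m≤n+m _ 0)
    occWeight-pos (suc j) = s≤s (m≤n+m _ (j + j))

  erase-keeps : ∀ t → KeepsOuterOccs ρ (u ∷ us) t us (sub (liftsS k (sub0 (ren ρ u))) t)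
  erase-keeps t i i∉ρ = occ-sub (liftsS-carries k carries) t
    where
    carries : Carries (sub0 (ren ρ u)) (suc i) i
    carries zero    = occ-ren-∉ i∉ρ u
    carries (suc j) = sym (occ-var-suc i j)

  copy-unfolds : ∀ t' → sub (jumpSub τ (u ∷ u ∷ us)) t' ≡ sub (jumpSub τ (u ∷ us)) (sub (liftsS k (var ∘ merge)) t')
  copy-unfolds t' =
    sym (trans (sub-sub (jumpSub (extend τ u) us) _ t')
               (sub-cong (λ j → trans (jumpSub-liftsS us (extend τ u) (var ∘ merge) j)
                                      (jumpSub-cong us pointwise j)) t'))
    where
    pointwise : extend τ u ∘ merge ≗ extend (extend τ u) u
    pointwise zero          = refl
    pointwise (suc zero)    = refl
    pointwise (suc (suc i)) = refl

  copy-lightens : ∀ t' → 1 ≤ occ (raiseR k zero) t' → 1 ≤ occ (raiseR k (suc zero)) t' →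
    stackWeight n (u ∷ u ∷ us) t' < stackWeight n (u ∷ us) (sub (liftsS k (var ∘ merge)) t')
  copy-lightens t' x-occurs y-occurs =
    subst (stackWeight n (u ∷ u ∷ us) t' <_) (sym (cong₂ (λ j M → occWeight j + M) (occ-sub-merges (liftsS-merges k merge-merges) t')
                                                      (stackWeight-liftsS us (var ∘ merge) t')))
          (occWeight-split (occ (raiseR k zero) t') (occ (raiseR k (suc zero)) t') _ x-occurs y-occurs)

  copy-keeps : ∀ t' → KeepsOuterOccs ρ (u ∷ us) (sub (liftsS k (var ∘ merge)) t') (u ∷ u ∷ us) t'
  copy-keeps t' i _ = sym (occ-sub (liftsS-carries k carries) t')
    where
    carries : Carries (var ∘ merge) (suc (suc i)) (suc i)
    carries zero          = refl
    carries (suc zero)    = refl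
    carries (suc (suc j)) = sym (occ-var-suc (suc i) (suc j))

stackStep-effect : ∀ {n₀ n} {ρ : Ren n₀ n} {τ : Sub n n₀} → τ ∘ ρ ≗ var →
  ∀ {us t us' t'} → StackStep ρ us t us' t' → Effect ρ τ us t us' t'
stackStep-effect {τ = τ} τρ≗var {us} (body s) = reduces [ sub-⟶ (jumpSub τ us) s ]
stackStep-effect {τ = τ} τρ≗var {u ∷ us} {t} (arg {u' = u'} s)
  with ⟶*-split (sub-⟶* (jumpSub-⟶* us {extend τ u} {extend τ u'} λ { zero → s ◅ ε ; (suc i) → ε }) t)
... | inj₁ unchanged = argument (sym unchanged) refl (here s) (λ _ _ → refl)
... | inj₂ reduced   = reduces reduced
stackStep-effect {ρ = ρ} {τ} τρ≗var {u ∷ us} {t} (deeper step)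
  with stackStep-effect {ρ = sucR ρ} {τ = extend τ u} τρ≗var step
... | reduces reduced = reduces reduced
... | lightens unfolds lighter keeps =
  lightens unfolds (subst (λ j → occWeight j + _ < _) (sym (keeps zero λ _ ())) (+-monoʳ-< _ lighter))
           (λ i i∉ρ → keeps (suc i) (λ j → i∉ρ j ∘ suc-injective))
... | argument unfolds same-weight args keeps =
  argument unfolds (cong₂ _+_ (cong occWeight (keeps zero λ _ ())) same-weight) (there args)
           (λ i i∉ρ → keeps (suc i) (λ j → i∉ρ j ∘ suc-injective))
stackStep-effect {ρ = ρ} {τ} τρ≗var {u ∷ us} {t} erase =
  lightens (erase-unfolds ρ τ τρ≗var u us t) (erase-lightens ρ τ τρ≗var u us t) (erase-keeps ρ τ τρ≗var u us t)
stackStep-effect {ρ = ρ} {τ} τρ≗var {u ∷ us} (copy t' refl x-occurs y-occurs) =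
  lightens (copy-unfolds ρ τ τρ≗var u us t') (copy-lightens ρ τ τρ≗var u us t' x-occurs y-occurs)
           (copy-keeps ρ τ τρ≗var u us t')

appsˡ-⟶ : ∀ {n} vs {H H' : Tm n} → H ⟶ H' → apps H vs ⟶ apps H' vs
appsˡ-⟶ []       s = s
appsˡ-⟶ (v ∷ vs) s = appsˡ-⟶ vs (appL s)

appsˡ-⟶⁺ : ∀ {n} vs {H H' : Tm n} → H ⟶⁺ H' → apps H vs ⟶⁺ apps H' vs
appsˡ-⟶⁺ vs [ s ]    = [ appsˡ-⟶ vs s ]
appsˡ-⟶⁺ vs (s ∷ ss) = appsˡ-⟶ vs s ∷ appsˡ-⟶⁺ vs ss

appsʳ-⟶ : ∀ {n} (H : Tm n) {vs vs'} → vs ⟶ₗ vs' → apps H vs ⟶ apps H vs'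
appsʳ-⟶ H {v ∷ vs} (here s)  = appsˡ-⟶ vs (appR s)
appsʳ-⟶ H {v ∷ vs} (there s) = appsʳ-⟶ (app H v) s

data Redex {n} (H v : Tm n) : Tm n → Set where
  dB : ∀ {m} (L : JL n m) s → H ≡ plug L (lam s) → Redex H v (plug L (jmp s (wkL L v)))

app-↦-inv : ∀ {n} {H v R : Tm n} → app H v ↦ R → Redex H v R
app-↦-inv r = go r refl
  where
  go : ∀ {X R H v} → X ↦ R → X ≡ app H v → Redex H v R
  go (dB s L u) refl = dB L s refl

plug-lam≢app : ∀ {n m} (L : JL n m) {s a b} → plug L (lam s) ≢ app a b
plug-lam≢app []      ()
plug-lam≢app (_ ∷ _) ()

data AppsStep {n} (H : Tm n) : List (Tm n) → Tm n → Set where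
  head  : ∀ {H' vs} → H ⟶ H' → AppsStep H vs (apps H' vs)
  args  : ∀ {vs vs'} → vs ⟶ₗ vs' → AppsStep H vs (apps H vs')
  redex : ∀ {v vs R} → Redex H v R → AppsStep H (v ∷ vs) (apps R vs)

apps-⟶-inv : ∀ {n} (H : Tm n) vs {r} → apps H vs ⟶ r → AppsStep H vs r
apps-⟶-inv H []       s = head s
apps-⟶-inv H (v ∷ vs) s with apps-⟶-inv (app H v) vs s
... | head (appL s')                 = head s'
... | head (appR s')                 = args (here s')
... | head (root r)                  = redex (app-↦-inv r)
... | args s'                        = args (there s')
... | redex (dB L _ app≡plug)        = ⊥-elim (plug-lam≢app L (sym app≡plug))

⟶⁺-reverse : ∀ {n} {a b : Tm n} → a ⟶⁺ b → TransClosure _⟵_ b a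
⟶⁺-reverse [ s ]    = [ s ]
⟶⁺-reverse (s ∷ ss) = ⟶⁺-reverse ss ∷ʳ s

SN⇒acc⁺ : ∀ {n} {t : Tm n} → SN t → Acc (flip _⟶⁺_) t
SN⇒acc⁺ sn = Subrelation.accessible ⟶⁺-reverse (accessible _⟵_ sn)

All-SN⇒acc : ∀ {n} {us : List (Tm n)} → All SN us → Acc (flip _⟶ₗ_) us
All-SN⇒acc []           = acc λ ()
All-SN⇒acc (sn-u ∷ sns) = cons sn-u (All-SN⇒acc sns)
  where
  cons : ∀ {u us} → SN u → Acc (flip _⟶ₗ_) us → Acc (flip _⟶ₗ_) (u ∷ us)
  cons (acc rs-u) acc-us@(acc rs-us) =
    acc λ { (here s) → cons (rs-u s) acc-us ; (there s) → cons (acc rs-u) (rs-us s) }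

stackStep-SN : ∀ {n₀ n} {ρ : Ren n₀ n} {us t us' t'} → All SN us → StackStep ρ us t us' t' → All SN us'
stackStep-SN sns            (body _)       = sns
stackStep-SN (acc rs ∷ sns) (arg s)        = rs s ∷ sns
stackStep-SN (sn ∷ sns)     (deeper step)  = sn ∷ stackStep-SN sns step
stackStep-SN (_ ∷ sns)      erase          = sns
stackStep-SN (sn ∷ sns)     (copy _ _ _ _) = sn ∷ sn ∷ sns

Key : ℕ → Set
Key n = Tm n × ℕ × List (Tm n)

infix 4 _≺_

-- The last component is well-founded only on lists of strongly normalising terms.

data _≺_ {n} : Key n → Key n → Set where
  reduct  : ∀ {X X' w w' us us'} → All SN us' → X ⟶⁺ X' → (X' , w' , us') ≺ (X , w , us)
  lighter : ∀ {X w w' us us'} → All SN us' → w' < w → (X , w' , us') ≺ (X , w , us)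
  argStep : ∀ {X w us us'} → us ⟶ₗ us' → (X , w , us') ≺ (X , w , us)

≺-acc : ∀ {n} {X : Tm n} {w us} → Acc (flip _⟶⁺_) X → Acc _<_ w → Acc (flip _⟶ₗ_) us → Acc _≺_ (X , w , us)
≺-rec : ∀ {n} {X : Tm n} {w us} → Acc (flip _⟶⁺_) X → Acc _<_ w → Acc (flip _⟶ₗ_) us →
  WfRec _≺_ (Acc _≺_) (X , w , us)

≺-acc acc-X acc-w acc-us = acc (≺-rec acc-X acc-w acc-us)

≺-rec (acc rx) _        _         (reduct sns' reduced) = ≺-acc (rx reduced) (<-wellFounded _) (All-SN⇒acc sns')
≺-rec acc-X    (acc rw) _         (lighter sns' lt)     = ≺-acc acc-X (rw lt) (All-SN⇒acc sns')
≺-rec acc-X    acc-w    (acc rus) (argStep us⟶ₗus')     = ≺-acc acc-X acc-w (rus us⟶ₗus')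

stackKey : ∀ {n} us → Tm (n ⊕ length us) → List (Tm n) → Key n
stackKey {n} us t vs = apps (sub (jumpSub var us) t) vs , stackWeight n us t , us

jumps-SN′ : ∀ {n} us (t : Tm (n ⊕ length us)) vs → All SN us → Acc _≺_ (stackKey us t vs) →
  SN (apps (jumps id us t) vs)
jumps-SN′ us t vs sns (acc smaller) = acc λ step → continue (apps-⟶-inv _ vs step)
  where
  continue : ∀ {r} → AppsStep (jumps id us t) vs r → SN r
  continue (head s) with jumps-⟶-inv (λ eq → eq) us t s
  ... | us' , t' , step , refl with stackStep-SN sns step | stackStep-effect (λ _ → refl) step
  ...   | sns' | reduces reduced =
    jumps-SN′ us' t' vs sns' (smaller (reduct sns' (appsˡ-⟶⁺ vs reduced)))
  ...   | sns' | lightens unfolds lighter' _ =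
    jumps-SN′ us' t' vs sns' (smaller (subst (λ X → (X , _) ≺ _) (cong (λ h → apps h vs) (sym unfolds))
                                             (lighter sns' lighter')))
  ...   | sns' | argument unfolds same-weight us⟶ₗus' _ =
    jumps-SN′ us' t' vs sns' (smaller (subst₂ (λ X w → (X , w , us') ≺ _)
                                              (cong (λ h → apps h vs) (sym unfolds)) (sym same-weight)
                                              (argStep us⟶ₗus')))
  continue (args {vs' = vs'} s) = jumps-SN′ us t vs' sns (smaller (reduct sns [ appsʳ-⟶ _ s ]))
  continue (redex {v} {vs₀} (dB L s jumps≡plug)) with jumps-plug-lam-inv id us t L s v jumps≡plug
  ... | t' , step , plug≡jumps =
    subst (λ h → SN (apps h vs₀)) (sym plug≡jumps)
          (jumps-SN′ us t' vs₀ sns (smaller (reduct sns [ appsˡ-⟶ vs₀ contracted ])))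
    where
    v≡ : sub (jumpSub var us) (weakens (length us) v) ≡ v
    v≡ = trans (jumpSub-weakens us var v) (sub-var v)
    contracted : app (sub (jumpSub var us) t) v ⟶ sub (jumpSub var us) t'
    contracted = subst (λ v' → app _ v' ⟶ _) v≡ (sub-⟶ _ step)

jumps-SN : ∀ {n} us (t : Tm (n ⊕ length us)) vs → All SN us →
  SN (apps (sub (jumpSub var us) t) vs) → SN (apps (jumps id us t) vs)
jumps-SN us t vs sns sn = jumps-SN′ us t vs sns (≺-acc (SN⇒acc⁺ sn) (<-wellFounded _) (All-SN⇒acc sns))

corollary3p4 : ∀ {n : ℕ} (t : Tm (suc n)) (u : Tm n) (vs : List (Tm n)) →
    Pure t → Pure u → All Pure vs →
    SN u → SN (apps (t [ u ]₀) vs) → SN (apps (jmp t u) vs)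
corollary3p4 t u vs _ _ _ sn-u sn =
  subst (λ u' → SN (apps (jmp t u') vs)) (ren-id u)
        (jumps-SN (u ∷ []) t vs (sn-u ∷ []) (subst (λ X → SN (apps X vs)) (sub-cong sub0≗ t) sn))
  where
  sub0≗ : sub0 u ≗ extend var u
  sub0≗ zero    = refl
  sub0≗ (suc i) = refl
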